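{- For every $k\geq 3$, the set $\Psi_k$ has the property that for any $\tau_1,\tau_2\in\Psi_k$, if $\mathrm{supp}\,\tau_1\cap\mathrm{supp}\,\tau_2=\{x\}$ for some $x\in D_k$, then the mark of $x$ in $\tau_1$ differs from the mark of $x$ in $\tau_2$. In particular, every spanning tree of the hypergraph $\mathcal{H}_k=(D_k,\Psi_k)$ is conflict-free.
   Context: Bitstrings: $\epsilon$ empty, $xy$ concatenation, $|x|$ length, $\overline{x}$ complement. $D_k$ is the set of bitstrings of length $2k$ with $k$ ones in which every prefix has at least as many ones as zeros; $D=\bigcup_{k\ge0}D_k$. For $x=b_1\cdots b_{2k}$ let $\widetilde{x}:=\overline{b_{2k}\cdots b_1}$. A marked Dyck word is $(x,m)$ with $x\in D_k$, $k\ge1$, $m\in[2k]$. A marked tuple on $D_k$ is an unordered set $\tau=\{(x_1,m_1),\ldots,(x_\ell,m_\ell)\}$, $\ell\ge3$, with $x_1,\ldots,x_\ell\in D_k$ distinct; $\mathrm{supp}\,\tau=\{x_1,\ldots,x_\ell\}$ and $m_i$ is the mark of $x_i$ in $\tau$. For bitstrings $u,v$ with $uv\in D$: $u\tau v:=\{(ux_1v,|u|+m_1),\ldots,(ux_\ell v,|u|+m_\ell)\}$; $\widetilde{\tau}:=\{(\widetilde{x_1},|x_1|+1-m_1),\ldots,(\widetilde{x_\ell},|x_\ell|+1-m_\ell)\}$. Patterns: $\Phi=\{\alpha(w):w\in D\}\cup\{\beta,\gamma,\delta\}$ where $\alpha(w)=\{(1w11000,|w|+5),(1w10100,|w|+6),(1w10010,|w|+2)\}$,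 $\beta=\{(111000,6),(101100,5),(101010,1)\}$, $\gamma=\{(11001100,2),(11011000,8),(11101000,6)\}$, $\delta=\{(111000,6),(110100,5),(101100,3),(101010,1)\}$. Let $\Psi=\{u\varphi v:\varphi\in\Phi,\ uv\in D,\ |u|\text{ even}\}\cup\{u\widetilde{\varphi}v:\varphi\in\Phi,\ uv\in D,\ |u|\text{ odd}\}$, and for $k\ge3$ let $\Psi_k$ be the set of members of $\Psi$ that are marked tuples on $D_k$. (Every member of $\Psi$ is a flippable tuple.) For a hypergraph $\mathcal{H}=(X,\mathcal{X})$ with $\mathcal{X}$ a set of such tuples and nonempty $U\subseteq X$, $\mathcal{H}[U]=(U,\{\tau\in\mathcal{X}:\mathrm{supp}\,\tau\subseteq U\})$. Spanning trees: if $|X|=1$ the only spanning tree is $\emptyset$; if $|X|\ge2$, $\mathcal{T}\subseteq\mathcal{X}$ is a spanning tree iff there exist an $\ell$-tuple $\tau\in\mathcal{T}$, a partition of $X$ into nonempty $X_1,\ldots,X_\ell$, and spanning trees $\mathcal{T}_i$ of $\mathcal{H}[X_i]$ with $\mathcal{T}=\{\tau\}\cup\mathcal{T}_1\cup\cdots\cup\mathcal{T}_\ell$ and $|\mathrm{supp}\,\tau\cap X_i|=1$ for all $i$. A spanning tree is conflict-free if (i) supports of any two of its tuples share at most one element and (ii) whenever distinct $\tau_1,\tau_2$ in it have a common support element $x$, the marks of $x$ in $\tau_1$ and $\tau_2$ differ. -}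

module Defs where

open import Data.Bool using (Bool; true; false; not)
open import Data.Nat using (ℕ; zero; suc; _+_; _*_; _∸_; _≤_)
open import Data.Nat.Divisibility using (_∣_)
open import Data.Fin using (Fin)
open import Data.List using (List; []; _∷_; _++_; length; map; reverse; take; concat)
open import Data.List.Membership.Propositional using (_∈_)
open import Data.List.Relation.Unary.All using (All)
open import Data.List.Relation.Unary.Unique.Propositional using (Unique)
open import Data.List.Relation.Binary.Permutation.Propositional using (_↭_)
open import Data.Product using (Σ; ∃; _×_; _,_; proj₁; proj₂)
open import Data.Sum using (_⊎_)
open import Relation.Nullary using (¬_)
open import Relation.Binary.PropositionalEquality using (_≡_; _≢_)
open import Function.Bundles using (_⇔_)

Word : Set
Word = List Bool

I O : Bool
I = true
O = false

ones : Word → ℕ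
ones []          = 0
ones (true ∷ x)  = suc (ones x)
ones (false ∷ x) = ones x

zeros : Word → ℕ
zeros []          = 0
zeros (true ∷ x)  = zeros x
zeros (false ∷ x) = suc (zeros x)

InD : ℕ → Word → Set
InD k x = (length x ≡ 2 * k) × (ones x ≡ k) × (∀ n → zeros (take n x) ≤ ones (take n x))

IsD : Word → Set
IsD x = ∃ λ k → InD k x

tilde : Word → Word
tilde x = map not (reverse x)

-- Marked words and tuples (a tuple is represented by a list of marked
-- words; as a set it is considered up to reordering)

MW : Set
MW = Word × ℕ

Tuple : Set
Tuple = List MW

supp : Tuple → List Word
supp τ = map proj₁ τ

wrap : Word → Tuple → Word → Tuple
wrap u τ v = map (λ p → (u ++ proj₁ p ++ v , length u + proj₂ p)) τ

tildeT : Tuple → Tuple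
tildeT τ = map (λ p → (tilde (proj₁ p) , suc (length (proj₁ p)) ∸ proj₂ p)) τ

MarkedTupleOn : ℕ → Tuple → Set
MarkedTupleOn k τ =
  (3 ≤ length τ) ×
  All (λ p → InD k (proj₁ p) × (1 ≤ proj₂ p) × (proj₂ p ≤ 2 * k)) τ ×
  Unique (supp τ)

alpha : Word → Tuple
alpha w =
  (I ∷ w ++ I ∷ I ∷ O ∷ O ∷ O ∷ [] , length w + 5) ∷
  (I ∷ w ++ I ∷ O ∷ I ∷ O ∷ O ∷ [] , length w + 6) ∷
  (I ∷ w ++ I ∷ O ∷ O ∷ I ∷ O ∷ [] , length w + 2) ∷ []

beta : Tuple
beta =
  (I ∷ I ∷ I ∷ O ∷ O ∷ O ∷ [] , 6) ∷
  (I ∷ O ∷ I ∷ I ∷ O ∷ O ∷ [] , 5) ∷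
  (I ∷ O ∷ I ∷ O ∷ I ∷ O ∷ [] , 1) ∷ []

gamma : Tuple
gamma =
  (I ∷ I ∷ O ∷ O ∷ I ∷ I ∷ O ∷ O ∷ [] , 2) ∷
  (I ∷ I ∷ O ∷ I ∷ I ∷ O ∷ O ∷ O ∷ [] , 8) ∷
  (I ∷ I ∷ I ∷ O ∷ I ∷ O ∷ O ∷ O ∷ [] , 6) ∷ []

delta : Tuple
delta =
  (I ∷ I ∷ I ∷ O ∷ O ∷ O ∷ [] , 6) ∷
  (I ∷ I ∷ O ∷ I ∷ O ∷ O ∷ [] , 5) ∷
  (I ∷ O ∷ I ∷ I ∷ O ∷ O ∷ [] , 3) ∷
  (I ∷ O ∷ I ∷ O ∷ I ∷ O ∷ [] , 1) ∷ []

data InΦ : Tuple → Set where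
  α-in : ∀ w → IsD w → InΦ (alpha w)
  β-in : InΦ beta
  γ-in : InΦ gamma
  δ-in : InΦ delta

data InΨ (τ : Tuple) : Set where
  even-in : ∀ φ u v → InΦ φ → IsD (u ++ v) → 2 ∣ length u →
            τ ↭ wrap u φ v → InΨ τ
  odd-in  : ∀ φ u v → InΦ φ → IsD (u ++ v) → ¬ (2 ∣ length u) →
            τ ↭ wrap u (tildeT φ) v → InΨ τ

InΨk : ℕ → Tuple → Set
InΨk k τ = InΨ τ × MarkedTupleOn k τ

EdgeOf : (Tuple → Set) → (Word → Set) → Tuple → Set
EdgeOf 𝒳 U τ = 𝒳 τ × All U (supp τ)

-- IsSpanningTree 𝒳 X T : T is a spanning tree of H[X], H having edge set 𝒳.
-- Vertex sets are predicates; a set of tuples is a list T (membership semantics).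
data IsSpanningTree (𝒳 : Tuple → Set) (X : Word → Set) (T : List Tuple) : Set₁ where
  leaf : (x : Word) → (∀ y → X y ⇔ (y ≡ x)) → T ≡ [] → IsSpanningTree 𝒳 X T
  node : (τ : Tuple) → EdgeOf 𝒳 X τ →
         (Xs : Fin (length τ) → Word → Set) →
         (∀ i → ∃ λ y → Xs i y) →
         (∀ i j y → Xs i y → Xs j y → i ≡ j) →
         (∀ y → X y ⇔ (∃ λ i → Xs i y)) →
         (∀ i → ∃ λ y → (y ∈ supp τ × Xs i y) ×
                        (∀ z → z ∈ supp τ → Xs i z → z ≡ y)) →
         (Ts : Fin (length τ) → List Tuple) →
         (∀ i → IsSpanningTree 𝒳 (Xs i) (Ts i)) →
         (∀ σ → σ ∈ T ⇔ (σ ≡ τ ⊎ ∃ λ i → σ ∈ Ts i)) →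
         IsSpanningTree 𝒳 X T

SameTuple : Tuple → Tuple → Set
SameTuple τ₁ τ₂ = ∀ p → p ∈ τ₁ ⇔ p ∈ τ₂

ConflictFree : List Tuple → Set
ConflictFree T =
  (∀ τ₁ τ₂ → τ₁ ∈ T → τ₂ ∈ T → ¬ SameTuple τ₁ τ₂ →
     ∀ y z → y ∈ supp τ₁ → y ∈ supp τ₂ → z ∈ supp τ₁ → z ∈ supp τ₂ → y ≡ z) ×
  (∀ τ₁ τ₂ → τ₁ ∈ T → τ₂ ∈ T → ¬ SameTuple τ₁ τ₂ →
     ∀ x m₁ m₂ → (x , m₁) ∈ τ₁ → (x , m₂) ∈ τ₂ → m₁ ≢ m₂)

module Submission where

open import Defs
open import Data.Nat using (ℕ; _≤_; zero; suc; _+_; _∸_; pred)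
open import Data.Nat.Properties using (+-suc; +-assoc; [m+n]∸[m+o]≡n∸o)
open import Data.Bool using (true; false; not)
open import Data.List using (List; []; _∷_; _++_; _ʳ++_; length; map; reverse)
open import Data.List.Properties using (++-assoc; ++-cancelˡ; length-++; ʳ++-ʳ++; reverse-++; unfold-reverse; map-++)
open import Data.List.Membership.Propositional using (_∈_)
open import Data.List.Membership.Propositional.Properties using (∈-map⁺; ∈-map⁻)
open import Data.List.Relation.Unary.Any using (here; there)
open import Data.List.Relation.Unary.All using () renaming (lookup to All-lookup; map to All-map)
open import Data.List.Relation.Binary.Permutation.Propositional using (_↭_; ↭-sym)
open import Data.List.Relation.Binary.Permutation.Propositional.Properties using (∈-resp-↭; map⁺)
open import Data.Product using (_×_; _,_; proj₁; proj₂; map₂; ∃)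
open import Data.Sum using (inj₁; inj₂)
open import Data.Empty using (⊥-elim)
open import Relation.Nullary using (¬_)
open import Relation.Binary.PropositionalEquality using (_≡_; _≢_; refl; sym; trans; cong; subst; module ≡-Reasoning)
open import Function.Bundles using (_⇔_; Equivalence)
open import Function.Properties.Equivalence using () renaming (refl to ⇔-refl)

open ≡-Reasoning

-- Every tuple of Ψ is "locally determined by its marks": for each
-- marked word (x , m) of a tuple τ ∈ Ψ, a fixed rewriting of the bits of x
-- within distance four of position m — independent of τ — yields another
-- word of supp τ, the partner of x at m.  Hence if x carries the same mark
-- m in two tuples of Ψ, both supports contain the partner of x at m, a word
-- different from x, so the supports meet in at least two words.  This gives
-- the first claim, and the second follows because two distinct tuples of a
-- spanning tree share at most one vertex.

-- A word with a focused position: the bits left of the focus, nearest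
-- first, and the bits from the focus on.
Zipper : Set
Zipper = Word × Word

plug : Zipper → Word
plug (L , R) = L ʳ++ R

focus : ℕ → Zipper → Zipper
focus zero    z           = z
focus (suc n) (L , [])    = L , []
focus (suc n) (L , b ∷ R) = focus n (b ∷ L , R)

focus-++ : ∀ u n L y → focus (length u + n) (L , u ++ y) ≡ focus n (u ʳ++ L , y)
focus-++ []      n L y = refl
focus-++ (b ∷ u) n L y = focus-++ u n (b ∷ L) y

-- The local rewriting rule, applied to the window around the focused
-- (marked) bit; a marked 1 looks to the right, a marked 0 to the left.
-- Windows matching no rule are left unchanged.
flipWindow : Zipper → Zipper
flipWindow (L , true ∷ false ∷ false ∷ r ∷ false ∷ R) = L , true ∷ true ∷ false ∷ false ∷ false ∷ R
flipWindow (L , true ∷ false ∷ false ∷ r ∷ true ∷ R)  = L , true ∷ true ∷ false ∷ r ∷ false ∷ R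
flipWindow (L , true ∷ false ∷ true ∷ r ∷ false ∷ R)  = L , true ∷ false ∷ false ∷ true ∷ false ∷ R
flipWindow (L , true ∷ false ∷ true ∷ r ∷ true ∷ R)   = L , true ∷ true ∷ true ∷ r ∷ false ∷ R
flipWindow (L , true ∷ true ∷ false ∷ R)              = L , true ∷ false ∷ true ∷ R
flipWindow (L , true ∷ true ∷ true ∷ r ∷ r' ∷ R)      = L , true ∷ true ∷ false ∷ r ∷ true ∷ R
flipWindow (false ∷ false ∷ l ∷ l' ∷ L , false ∷ R)   = false ∷ true ∷ l ∷ false ∷ L , false ∷ R
flipWindow (false ∷ true ∷ L , false ∷ R)             = true ∷ false ∷ L , false ∷ R
flipWindow (true ∷ false ∷ l ∷ false ∷ L , false ∷ R) = true ∷ false ∷ false ∷ true ∷ L , false ∷ R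
flipWindow (true ∷ false ∷ l ∷ true ∷ L , false ∷ R)  = true ∷ true ∷ false ∷ true ∷ L , false ∷ R
flipWindow (true ∷ true ∷ l ∷ false ∷ L , false ∷ R)  = true ∷ false ∷ l ∷ true ∷ L , false ∷ R
flipWindow (true ∷ true ∷ l ∷ true ∷ L , false ∷ R)   = false ∷ true ∷ true ∷ true ∷ L , false ∷ R
flipWindow z = z

-- The partner of x at the (1-based) mark m.
partner : Word → ℕ → Word
partner x m = plug (flipWindow (focus (pred m) ([] , x)))

partner-local : ∀ a y n →
  partner (a ++ y) (length a + suc n) ≡ plug (flipWindow (focus n (a ʳ++ [] , y)))
partner-local a y n rewrite +-suc (length a) n =
  cong (λ z → plug (flipWindow z)) (focus-++ a n [] y)

record PartnerIn (τ : Tuple) (x : Word) (m : ℕ) : Set where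
  constructor partnerIn
  field
    partner∈ : partner x m ∈ supp τ
    partner≢ : partner x m ≢ x

partnerVia : ∀ {τ x x' m m'} a {y y'} {n} → x ≡ a ++ y → x' ≡ a ++ y' → m ≡ length a + suc n →
  (x' , m') ∈ τ → plug (flipWindow (focus n (a ʳ++ [] , y))) ≡ (a ʳ++ []) ʳ++ y' → y' ≢ y →
  PartnerIn τ x m
partnerVia {τ} a {y} {y'} {n} refl refl refl x'∈τ window y'≢y =
  partnerIn (subst (_∈ supp τ) (sym partner≡) (∈-map⁺ proj₁ x'∈τ))
            λ e → y'≢y (++-cancelˡ a y' y (trans (sym partner≡) e))
  where
  partner≡ : partner (a ++ y) (length a + suc n) ≡ a ++ y'
  partner≡ = begin
    partner (a ++ y) (length a + suc n)          ≡⟨ partner-local a y n ⟩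
    plug (flipWindow (focus n (a ʳ++ [] , y)))   ≡⟨ window ⟩
    (a ʳ++ []) ʳ++ y'                            ≡⟨ ʳ++-ʳ++ a ⟩
    a ++ y'                                      ∎

wrap-∈ : ∀ u v {φ s m} → (s , m) ∈ φ → (u ++ s ++ v , length u + m) ∈ wrap u φ v
wrap-∈ u v = ∈-map⁺ _

-- partnerVia for two words s, s' of a pattern φ placed in the context u _ v
-- (the first membership only fixes the marked word s and its mark).
partnerAt : ∀ u v {φ s s' m'} {n} → (s , suc n) ∈ φ → (s' , m') ∈ φ →
  plug (flipWindow (focus n (u ʳ++ [] , s ++ v))) ≡ (u ʳ++ []) ʳ++ (s' ++ v) → s' ++ v ≢ s ++ v →
  PartnerIn (wrap u φ v) (u ++ s ++ v) (length u + suc n)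
partnerAt u v _ s'∈φ = partnerVia u refl refl refl (wrap-∈ u v s'∈φ)

-- α(w) = {1 w t : t ∈ {11000, 10100, 10010}}: the window lies in t, with the
-- prefix u 1 w as left context.
alpha-split : ∀ u w t v → u ++ (true ∷ w ++ t) ++ v ≡ (u ++ true ∷ w) ++ (t ++ v)
alpha-split u w t v = begin
  u ++ true ∷ (w ++ t) ++ v   ≡⟨ cong (λ z → u ++ true ∷ z) (++-assoc w t v) ⟩
  u ++ true ∷ w ++ t ++ v     ≡⟨ sym (++-assoc u (true ∷ w) (t ++ v)) ⟩
  (u ++ true ∷ w) ++ (t ++ v) ∎

alpha-mark : ∀ u w n → length u + (length w + suc (suc n)) ≡ length (u ++ true ∷ w) + suc n
alpha-mark u w n = begin
  length u + (length w + suc (suc n)) ≡⟨ cong (length u +_) (+-suc (length w) (suc n)) ⟩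
  length u + (suc (length w) + suc n) ≡⟨ sym (+-assoc (length u) (suc (length w)) (suc n)) ⟩
  length u + suc (length w) + suc n   ≡⟨ cong (_+ suc n) (sym (length-++ u)) ⟩
  length (u ++ true ∷ w) + suc n      ∎

partnerAlpha : ∀ u v w {φ t t' m'} {n} → (true ∷ w ++ t , length w + suc (suc n)) ∈ φ →
  (true ∷ w ++ t' , m') ∈ φ →
  plug (flipWindow (focus n ((u ++ true ∷ w) ʳ++ [] , t ++ v))) ≡ ((u ++ true ∷ w) ʳ++ []) ʳ++ (t' ++ v) →
  t' ++ v ≢ t ++ v →
  PartnerIn (wrap u φ v) (u ++ (true ∷ w ++ t) ++ v) (length u + (length w + suc (suc n)))
partnerAlpha u v w {t = t} {t'} {n = n} _ t'∈φ =
  partnerVia (u ++ true ∷ w) (alpha-split u w t v) (alpha-split u w t' v) (alpha-mark u w n) (wrap-∈ u v t'∈φ)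

-- Each case names the
-- partner within the pattern; the window equation holds by computation and
-- the partner differs from the word in a bit of the window.
partnerΦ : ∀ u v {φ s m} → InΦ φ → (s , m) ∈ φ → PartnerIn (wrap u φ v) (u ++ s ++ v) (length u + m)
partnerΦ u v (α-in w _) s∈@(here refl)                 = partnerAlpha u v w s∈ (there (here refl)) refl (λ ())
partnerΦ u v (α-in w _) s∈@(there (here refl))         = partnerAlpha u v w s∈ (there (there (here refl))) refl (λ ())
partnerΦ u v (α-in w _) s∈@(there (there (here refl))) = partnerAlpha u v w s∈ (here refl) refl (λ ())
partnerΦ u v β-in s∈@(here refl)                         = partnerAt u v s∈ (there (here refl)) refl (λ ())
partnerΦ u v β-in s∈@(there (here refl))                 = partnerAt u v s∈ (here refl) refl (λ ())
partnerΦ u v β-in s∈@(there (there (here refl)))         = partnerAt u v s∈ (here refl) refl (λ ())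
partnerΦ u v γ-in s∈@(here refl)                         = partnerAt u v s∈ (there (there (here refl))) refl (λ ())
partnerΦ u v γ-in s∈@(there (here refl))                 = partnerAt u v s∈ (here refl) refl (λ ())
partnerΦ u v γ-in s∈@(there (there (here refl)))         = partnerAt u v s∈ (there (here refl)) refl (λ ())
partnerΦ u v δ-in s∈@(here refl)                         = partnerAt u v s∈ (there (there (here refl))) refl (λ ())
partnerΦ u v δ-in s∈@(there (here refl))                 = partnerAt u v s∈ (there (there (here refl))) refl (λ ())
partnerΦ u v δ-in s∈@(there (there (here refl)))         = partnerAt u v s∈ (there (there (there (here refl)))) refl (λ ())
partnerΦ u v δ-in s∈@(there (there (there (here refl)))) = partnerAt u v s∈ (here refl) refl (λ ())

-- In the reversed complement of 1 w t the window lies in the reversed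
-- complement of t, with u as left context.
tilde-alpha : ∀ w t → tilde (true ∷ w ++ t) ≡ tilde t ++ tilde w ++ false ∷ []
tilde-alpha w t = begin
  map not (reverse (true ∷ w ++ t))              ≡⟨ cong (map not) (reverse-++ (true ∷ w) t) ⟩
  map not (reverse t ++ reverse (true ∷ w))      ≡⟨ map-++ not (reverse t) _ ⟩
  tilde t ++ map not (reverse (true ∷ w))        ≡⟨ cong (λ z → tilde t ++ map not z) (unfold-reverse true w) ⟩
  tilde t ++ map not (reverse w ++ true ∷ [])    ≡⟨ cong (tilde t ++_) (map-++ not (reverse w) _) ⟩
  tilde t ++ tilde w ++ false ∷ []               ∎

tilde-alpha-split : ∀ u w t v → u ++ tilde (true ∷ w ++ t) ++ v ≡ u ++ (tilde t ++ (tilde w ++ false ∷ []) ++ v)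
tilde-alpha-split u w t v = cong (u ++_) (begin
  tilde (true ∷ w ++ t) ++ v               ≡⟨ cong (_++ v) (tilde-alpha w t) ⟩
  (tilde t ++ tilde w ++ false ∷ []) ++ v  ≡⟨ ++-assoc (tilde t) _ v ⟩
  tilde t ++ (tilde w ++ false ∷ []) ++ v  ∎)

tilde-alpha-mark : ∀ w t c → suc (length (true ∷ w ++ t)) ∸ (length w + c) ≡ suc (suc (length t)) ∸ c
tilde-alpha-mark w t c = begin
  suc (suc (length (w ++ t))) ∸ (length w + c)      ≡⟨ cong (λ l → suc (suc l) ∸ (length w + c)) (length-++ w) ⟩
  suc (suc (length w + length t)) ∸ (length w + c)  ≡⟨ cong (λ l → suc l ∸ (length w + c)) (sym (+-suc (length w) (length t))) ⟩
  suc (length w + suc (length t)) ∸ (length w + c)  ≡⟨ cong (_∸ (length w + c)) (sym (+-suc (length w) (suc (length t)))) ⟩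
  length w + suc (suc (length t)) ∸ (length w + c)  ≡⟨ [m+n]∸[m+o]≡n∸o (length w) (suc (suc (length t))) c ⟩
  suc (suc (length t)) ∸ c                          ∎

partnerTildeAlpha : ∀ u v w {φ t t' m'} {c n} →
  (tilde (true ∷ w ++ t) , suc (length (true ∷ w ++ t)) ∸ (length w + c)) ∈ φ →
  (tilde (true ∷ w ++ t') , m') ∈ φ →
  suc (suc (length t)) ∸ c ≡ suc n →
  plug (flipWindow (focus n (u ʳ++ [] , tilde t ++ (tilde w ++ false ∷ []) ++ v))) ≡
    (u ʳ++ []) ʳ++ (tilde t' ++ (tilde w ++ false ∷ []) ++ v) →
  tilde t' ++ (tilde w ++ false ∷ []) ++ v ≢ tilde t ++ (tilde w ++ false ∷ []) ++ v →
  PartnerIn (wrap u φ v) (u ++ tilde (true ∷ w ++ t) ++ v)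
            (length u + (suc (length (true ∷ w ++ t)) ∸ (length w + c)))
partnerTildeAlpha u v w {t = t} {t'} {c = c} _ t'∈φ mark≡ =
  partnerVia u (tilde-alpha-split u w t v) (tilde-alpha-split u w t' v)
             (cong (length u +_) (trans (tilde-alpha-mark w t c) mark≡)) (wrap-∈ u v t'∈φ)

partnerΦ~ : ∀ u v {φ s m} → InΦ φ → (s , m) ∈ tildeT φ →
  PartnerIn (wrap u (tildeT φ) v) (u ++ s ++ v) (length u + m)
partnerΦ~ u v β-in s∈@(here refl)                         = partnerAt u v s∈ (there (here refl)) refl (λ ())
partnerΦ~ u v β-in s∈@(there (here refl))                 = partnerAt u v s∈ (here refl) refl (λ ())
partnerΦ~ u v β-in s∈@(there (there (here refl)))         = partnerAt u v s∈ (there (here refl)) refl (λ ())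
partnerΦ~ u v γ-in s∈@(here refl)                         = partnerAt u v s∈ (there (here refl)) refl (λ ())
partnerΦ~ u v γ-in s∈@(there (here refl))                 = partnerAt u v s∈ (here refl) refl (λ ())
partnerΦ~ u v γ-in s∈@(there (there (here refl)))         = partnerAt u v s∈ (there (here refl)) refl (λ ())
partnerΦ~ u v δ-in s∈@(here refl)                         = partnerAt u v s∈ (there (there (here refl))) refl (λ ())
partnerΦ~ u v δ-in s∈@(there (here refl))                 = partnerAt u v s∈ (there (there (here refl))) refl (λ ())
partnerΦ~ u v δ-in s∈@(there (there (here refl)))         = partnerAt u v s∈ (there (there (there (here refl)))) refl (λ ())
partnerΦ~ u v δ-in s∈@(there (there (there (here refl)))) = partnerAt u v s∈ (there (there (here refl))) refl (λ ())
partnerΦ~ u v (α-in w _) s∈@(here refl)                 = partnerTildeAlpha u v w s∈ (there (here refl)) refl refl (λ ())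
partnerΦ~ u v (α-in w _) s∈@(there (here refl))         = partnerTildeAlpha u v w s∈ (there (there (here refl))) refl refl (λ ())
partnerΦ~ u v (α-in w _) s∈@(there (there (here refl))) = partnerTildeAlpha u v w s∈ (here refl) refl refl (λ ())

partner-resp-↭ : ∀ {τ σ x m} → τ ↭ σ → PartnerIn σ x m → PartnerIn τ x m
partner-resp-↭ τ↭σ (partnerIn p∈σ p≢x) = partnerIn (∈-resp-↭ (map⁺ proj₁ (↭-sym τ↭σ)) p∈σ) p≢x

partnerΨ : ∀ {τ x m} → InΨ τ → (x , m) ∈ τ → PartnerIn τ x m
partnerΨ (even-in φ u v φ∈Φ _ _ τ↭) x∈τ with ∈-map⁻ _ (∈-resp-↭ τ↭ x∈τ)
... | (s , m) , s∈φ , refl = partner-resp-↭ τ↭ (partnerΦ u v φ∈Φ s∈φ)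
partnerΨ (odd-in φ u v φ∈Φ _ _ τ↭) x∈τ with ∈-map⁻ _ (∈-resp-↭ τ↭ x∈τ)
... | (s , m) , s∈φ , refl = partner-resp-↭ τ↭ (partnerΦ~ u v φ∈Φ s∈φ)

Ψ-marks-differ : ∀ {τ₁ τ₂ x m₁ m₂} → InΨ τ₁ → InΨ τ₂ →
  (∀ y → y ∈ supp τ₁ → y ∈ supp τ₂ → y ≡ x) →
  (x , m₁) ∈ τ₁ → (x , m₂) ∈ τ₂ → m₁ ≢ m₂
Ψ-marks-differ ψ₁ ψ₂ only-x x∈τ₁ x∈τ₂ refl with partnerΨ ψ₁ x∈τ₁ | partnerΨ ψ₂ x∈τ₂
... | partnerIn p∈τ₁ p≢x | partnerIn p∈τ₂ _ = p≢x (only-x _ p∈τ₁ p∈τ₂)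

tree-edge : ∀ {𝒳 X T} → IsSpanningTree 𝒳 X T → ∀ {σ} → σ ∈ T → EdgeOf 𝒳 X σ
tree-edge (leaf _ _ refl) ()
tree-edge (node τ τ-edge Xs _ _ cover _ Ts subtree T≡) {σ} σ∈T with Equivalence.to (T≡ σ) σ∈T
... | inj₁ refl          = τ-edge
... | inj₂ (i , σ∈Tᵢ) =
  map₂ (All-map (λ {y} y∈Xᵢ → Equivalence.from (cover y) (i , y∈Xᵢ))) (tree-edge (subtree i) σ∈Tᵢ)

tree-vertex : ∀ {𝒳 X T σ y} → IsSpanningTree 𝒳 X T → σ ∈ T → y ∈ supp σ → X y
tree-vertex tree σ∈T = All-lookup (proj₂ (tree-edge tree σ∈T))

single-common : ∀ {τ : Tuple} {P : Word → Set} →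
  (∃ λ w → (w ∈ supp τ × P w) × (∀ z → z ∈ supp τ → P z → z ≡ w)) →
  ∀ {y z} → y ∈ supp τ → P y → z ∈ supp τ → P z → y ≡ z
single-common (_ , _ , unique) y∈τ Py z∈τ Pz = trans (unique _ y∈τ Py) (sym (unique _ z∈τ Pz))

-- Two different tuples of a spanning tree share at most one vertex: at the
-- root, a subtree meets the root tuple only in the single vertex of supp τ
-- in its part, and subtrees over different parts are vertex-disjoint.
tree-linear : ∀ {𝒳 X T} → IsSpanningTree 𝒳 X T →
  ∀ σ₁ σ₂ → σ₁ ∈ T → σ₂ ∈ T → ¬ SameTuple σ₁ σ₂ →
  ∀ y z → y ∈ supp σ₁ → y ∈ supp σ₂ → z ∈ supp σ₁ → z ∈ supp σ₂ → y ≡ z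
tree-linear (leaf _ _ refl) _ _ ()
tree-linear (node τ _ Xs _ disjoint _ single Ts subtree T≡) σ₁ σ₂ σ₁∈T σ₂∈T σ₁≉σ₂ y z y∈σ₁ y∈σ₂ z∈σ₁ z∈σ₂
  with Equivalence.to (T≡ σ₁) σ₁∈T | Equivalence.to (T≡ σ₂) σ₂∈T
... | inj₁ refl | inj₁ refl = ⊥-elim (σ₁≉σ₂ (λ _ → ⇔-refl))
... | inj₁ refl | inj₂ (i , σ₂∈Tᵢ) =
  single-common (single i) y∈σ₁ (tree-vertex (subtree i) σ₂∈Tᵢ y∈σ₂)
                           z∈σ₁ (tree-vertex (subtree i) σ₂∈Tᵢ z∈σ₂)
... | inj₂ (i , σ₁∈Tᵢ) | inj₁ refl =
  single-common (single i) y∈σ₂ (tree-vertex (subtree i) σ₁∈Tᵢ y∈σ₁)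
                           z∈σ₂ (tree-vertex (subtree i) σ₁∈Tᵢ z∈σ₁)
... | inj₂ (i , σ₁∈Tᵢ) | inj₂ (j , σ₂∈Tⱼ)
  with disjoint i j y (tree-vertex (subtree i) σ₁∈Tᵢ y∈σ₁) (tree-vertex (subtree j) σ₂∈Tⱼ y∈σ₂)
...   | refl = tree-linear (subtree i) σ₁ σ₂ σ₁∈Tᵢ σ₂∈Tⱼ σ₁≉σ₂ y z y∈σ₁ y∈σ₂ z∈σ₁ z∈σ₂

tree-conflict-free : ∀ {𝒳 X T} → (∀ {τ} → 𝒳 τ → InΨ τ) → IsSpanningTree 𝒳 X T → ConflictFree T
tree-conflict-free {T = T} 𝒳⊆Ψ tree = tree-linear tree , marks-differ
  where
  marks-differ : ∀ σ₁ σ₂ → σ₁ ∈ T → σ₂ ∈ T → ¬ SameTuple σ₁ σ₂ →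
    ∀ x m₁ m₂ → (x , m₁) ∈ σ₁ → (x , m₂) ∈ σ₂ → m₁ ≢ m₂
  marks-differ σ₁ σ₂ σ₁∈T σ₂∈T σ₁≉σ₂ x m₁ m₂ x∈σ₁ x∈σ₂ =
    Ψ-marks-differ (𝒳⊆Ψ (proj₁ (tree-edge tree σ₁∈T))) (𝒳⊆Ψ (proj₁ (tree-edge tree σ₂∈T)))
      (λ y y∈σ₁ y∈σ₂ → tree-linear tree σ₁ σ₂ σ₁∈T σ₂∈T σ₁≉σ₂ y x y∈σ₁ y∈σ₂ (∈-map⁺ proj₁ x∈σ₁) (∈-map⁺ proj₁ x∈σ₂))
      x∈σ₁ x∈σ₂

lemma9 : (k : ℕ) → 3 ≤ k →
    ((τ₁ τ₂ : Tuple) → InΨk k τ₁ → InΨk k τ₂ →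
       (x : Word) → InD k x →
       (∀ y → (y ∈ supp τ₁ × y ∈ supp τ₂) ⇔ (y ≡ x)) →
       (m₁ m₂ : ℕ) → (x , m₁) ∈ τ₁ → (x , m₂) ∈ τ₂ → m₁ ≢ m₂)
    ×
    ((T : List Tuple) → IsSpanningTree (InΨk k) (InD k) T → ConflictFree T)
lemma9 k _ =
  (λ τ₁ τ₂ ψ₁ ψ₂ x _ common≡x _ _ →
     Ψ-marks-differ (proj₁ ψ₁) (proj₁ ψ₂) (λ y y∈τ₁ y∈τ₂ → Equivalence.to (common≡x y) (y∈τ₁ , y∈τ₂))) ,
  (λ T → tree-conflict-free proj₁)
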